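{- Let $(C,\phi)$ be a multistate monotone system and $k\in\{1,\ldots,M\}$. For $\bm{y}\in\mathfrak{C}\setminus\{\bm{0}\}$ let $A(\bm{y})=\{i:y_i>0\}$, and define the binary monotone system $(A(\bm{y}),\psi_k^{\bm{y}})$ by $$\psi_k^{\bm{y}}(\bm{z})=\phi_k\big(\bm{y}-(\bm{1}^{A(\bm{y})},\bm{0})+(\bm{z},\bm{0})\big),\qquad \bm{z}\in\{0,1\}^{A(\bm{y})},$$ where $(\bm{z},\bm{0})$ is the vector in $\{0,1\}^n$ whose entries indexed by $A(\bm{y})$ are given by $\bm{z}$ and whose other entries are $0$, and $(\bm{1}^{A(\bm{y})},\bm{0})$ is the indicator vector of $A(\bm{y})$. Then $\delta_k(\bm{y})=d(\psi_k^{\bm{y}})$.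
   Context: A multistate monotone system (MMS) $(C,\phi)$ has component set $C=\{1,\ldots,n\}$, component state sets $\mathcal{S}_i=\{0,1,\ldots,m_i\}$, component state space $\mathfrak{C}=\mathcal{S}_1\times\cdots\times\mathcal{S}_n$, system state set $\{0,1,\ldots,M\}$, and a structure function $\phi:\mathfrak{C}\to\{0,\ldots,M\}$ non-decreasing in each argument; $\phi_k(\bm{x})=\mathrm{I}(\phi(\bm{x})\ge k)$. Vectors are ordered componentwise. For a binary-valued non-decreasing function $f$ on a product of state sets, a minimal path vector is $\bm{x}$ with $f(\bm{x})=1$ and $f(\bm{y})=0$ for all $\bm{y}\le\bm{x}$, $\bm{y}\ne\bm{x}$; with $\mathfrak{P}$ the set of these, $\mathrm{cl}(\mathfrak{P})$ is the smallest set containing $\mathfrak{P}$ closed under componentwise maximum. A formation of $\bm{x}\in\mathrm{cl}(\mathfrak{P})$ is a nonempty subset $\{\bm{x}_{i_1},\ldots,\bm{x}_{i_j}\}\subseteq\mathfrak{P}$ whose componentwise maximum is $\bm{x}$, odd/even according to parity of $j$. The signed domination function is $\delta(\bm{x})=$ (number of odd formations) $-$ (number of even formations) on $\mathrm{cl}(\mathfrak{P})$ and $0$ elsewhere; $\delta_k$ denotes this function for $f=\phi_k$. The signed domination $d(f)$ is $\delta$ evaluated at the maximal state vector; for the binary system $\psi_k^{\bm{y}}$ (component state sets $\{0,1\}$) this is the all-ones vector on $A(\bm{y})$. -}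

module Defs where

open import Data.Nat using (ℕ; zero; suc; _∸_; _≤_; _<_; _⊔_; _≤ᵇ_; _≡ᵇ_; _<ᵇ_)
open import Data.Nat.Base using (NonZero)
open import Data.Bool using (Bool; true; false; _∧_; _∨_; not; if_then_else_)
open import Data.Fin using (Fin; zero; suc; toℕ)
import Data.Nat
open import Data.List using (List; []; _∷_; _++_; map; concatMap; upTo; allFin; filter; length; foldr; lookup)
open import Data.Nat.ListAction using (sum)
import Data.List as L
open import Data.Integer using (ℤ; +_; -[1+_]) renaming (_+_ to _+ℤ_)
open import Relation.Binary.PropositionalEquality using (_≡_)

-- State vectors of n components are functions Fin n → ℕ.
-- A product of state sets S₁ × ⋯ × Sₙ with Sᵢ = {0,…,m i} is given by
-- the bound function m : Fin n → ℕ.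

Vec' : ℕ → Set
Vec' n = Fin n → ℕ

states : (n : ℕ) → (Fin n → ℕ) → List (Vec' n)
states zero    m = (λ ()) ∷ []
states (suc n) m =
  concatMap (λ v → map (λ k → cons k v) (upTo (suc (m zero)))) (states n (λ i → m (suc i)))
  where
  cons : ℕ → Vec' n → Vec' (suc n)
  cons k v zero    = k
  cons k v (suc i) = v i

all : {A : Set} → (A → Bool) → List A → Bool
all p []       = true
all p (x ∷ xs) = p x ∧ all p xs

_≤ᵥ_ : {n : ℕ} → Vec' n → Vec' n → Bool
_≤ᵥ_ {n} x y = all (λ i → x i ≤ᵇ y i) (allFin n)

_≡ᵥ_ : {n : ℕ} → Vec' n → Vec' n → Bool
_≡ᵥ_ {n} x y = all (λ i → x i ≡ᵇ y i) (allFin n)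

vmax : {n : ℕ} → List (Vec' n) → Vec' n
vmax xs i = foldr (λ v acc → v i ⊔ acc) 0 xs

isMinPath : (n : ℕ) (m : Fin n → ℕ) (f : Vec' n → Bool) → Vec' n → Bool
isMinPath n m f x =
  f x ∧ all (λ y → not (y ≤ᵥ x) ∨ (y ≡ᵥ x) ∨ not (f y)) (states n m)

minPaths : (n : ℕ) (m : Fin n → ℕ) (f : Vec' n → Bool) → List (Vec' n)
minPaths n m f = L.filterᵇ (isMinPath n m f) (states n m)

subsets : {A : Set} → List A → List (List A)
subsets []       = [] ∷ []
subsets (x ∷ xs) = subsets xs ++ map (x ∷_) (subsets xs)

nonEmpty : {A : Set} → List A → Bool
nonEmpty []      = false
nonEmpty (_ ∷ _) = true

odd : ℕ → Bool
odd zero    = false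
odd (suc k) = not (odd k)

sumℤ : List ℤ → ℤ
sumℤ = foldr _+ℤ_ (+ 0)

sign : ℕ → ℤ
sign j = if odd j then + 1 else -[1+ 0 ]

-- Signed domination function δ(x): (#odd formations) − (#even formations),
-- a formation of x being a nonempty subset of 𝔓 whose componentwise
-- maximum is x. (For x ∉ cl(𝔓) there are no formations, so δ(x) = 0.)
δ : (n : ℕ) (m : Fin n → ℕ) (f : Vec' n → Bool) → Vec' n → ℤ
δ n m f x =
  sumℤ (map (λ S → if nonEmpty S ∧ (vmax S ≡ᵥ x) then sign (length S) else + 0)
            (subsets (minPaths n m f)))

InStates : {n : ℕ} → (Fin n → ℕ) → Vec' n → Set
InStates m x = ∀ i → x i ≤ m i

record MMS : Set where
  field
    n   : ℕ
    m   : Fin n → ℕ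
    M   : ℕ
    φ   : Vec' n → ℕ
    φ-range : ∀ x → InStates m x → φ x ≤ M
    φ-mono  : ∀ x y → InStates m x → InStates m y →
              (∀ i → x i ≤ y i) → φ x ≤ φ y

φₖ : (S : MMS) → ℕ → Vec' (MMS.n S) → Bool
φₖ S k x = k ≤ᵇ MMS.φ S x

Alist : {n : ℕ} → Vec' n → List (Fin n)
Alist {n} y = L.filterᵇ (λ i → 0 <ᵇ y i) (allFin n)

∣A∣ : {n : ℕ} → Vec' n → ℕ
∣A∣ y = length (Alist y)

embA : {n : ℕ} (y : Vec' n) → Fin (∣A∣ y) → Fin n
embA y = lookup (Alist y)

-- (z, 0): entries indexed by A(y) given by z, other entries 0
ext : {n : ℕ} (y : Vec' n) → Vec' (∣A∣ y) → Vec' n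
ext y z i = sum (map (λ j → if toℕ (embA y j) ≡ᵇ toℕ i then z j else 0) (allFin (∣A∣ y)))

indA : {n : ℕ} → Vec' n → Vec' n
indA y i = if 0 <ᵇ y i then 1 else 0

ψ : (S : MMS) (k : ℕ) (y : Vec' (MMS.n S)) → Vec' (∣A∣ y) → Bool
ψ S k y z = (φₖ S k) (λ i → (y i ∸ indA y i) Data.Nat.+ ext y z i)

-- d(ψ_k^y): δ of the binary system (component state sets {0,1}) at the
-- all-ones vector on A(y)
dψ : (S : MMS) (k : ℕ) (y : Vec' (MMS.n S)) → ℤ
dψ S k y = δ (∣A∣ y) (λ _ → 1) (ψ S k y) (λ _ → 1)

δₖ : (S : MMS) → ℕ → Vec' (MMS.n S) → ℤ
δₖ S k = δ (MMS.n S) (MMS.m S) (φₖ S k)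

-- Both sides are instances of one expansion: for monotone f and a state vector x,
--   δ(x) = ∑_{I ⊆ A(x)} (−1)^{|I|} f(x − 1_I).
-- A set S of minimal path vectors has maximum x iff all of S lies below x and, for no
-- i ∈ A(x), all of S lies below x − eᵢ. Inclusion–exclusion over these i, followed by
-- summing over S, turns the signed count of formations of x into the alternating sum
-- of the indicators that some minimal path vector lies below x − 1_I, that is, of
-- f(x − 1_I). For ψ_k^y at the all-ones vector the subsets J of A(y) index the same
-- terms, since ψ_k^y(1 − 1_J) = φ_k(y − 1_J).

module Submission where

open import Defs
open import Data.Nat using (ℕ; _≤_; _≡ᵇ_)
open import Data.Fin using (Fin)
open import Data.Product using (_×_)
open import Relation.Nullary using (¬_)
open import Relation.Binary.PropositionalEquality using (_≡_)

open import Data.Bool using (Bool; true; false; _∧_; _∨_; not; if_then_else_; T; T?)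
open import Data.Bool.Properties using (T-∧; T-∨)
open import Data.Empty using (⊥-elim)
open import Data.Fin as Fin using (toℕ; zero; suc)
open import Data.Fin.Properties using (toℕ-injective)
open import Data.Integer using (ℤ; +_; -_; _+_; _*_; _-_)
import Data.Integer.Properties as ℤ
open import Algebra.Properties.CommutativeSemigroup ℤ.*-commutativeSemigroup using (x∙yz≈y∙xz)
open import Data.Integer.Tactic.RingSolver using (solve-∀)
open import Data.List using (List; []; _∷_; _++_; map; length; allFin; lookup; tabulate)
import Data.List.Properties as List
open import Data.List.Membership.Propositional using (_∈_; find; lose)
open import Data.List.Membership.Propositional.Properties
  using (∈-allFin; ∈-filter⁺; ∈-filter⁻; ∈-++⁻; ∈-map⁺; ∈-map⁻; ∈-concatMap⁺; ∈-concatMap⁻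
        ; ∈-upTo⁺; ∈-upTo⁻; ∈-lookup)
import Data.List.Relation.Unary.All as All
open import Data.List.Relation.Unary.AllPairs using (_∷_)
open import Data.List.Relation.Unary.Any using (here; there)
open import Data.List.Relation.Unary.Unique.Propositional using (Unique)
import Data.List.Relation.Unary.Unique.Propositional.Properties as Unique
open import Data.Nat as ℕ using (zero; suc; _<_; _<ᵇ_; _∸_; z≤n; s≤s)
open import Data.Nat.Induction using (<-wellFounded)
open import Data.Nat.ListAction using (sum)
import Data.Nat.Properties as ℕ
open import Data.Product using (∃-syntax; _,_; proj₁; proj₂)
open import Data.Sum using (inj₁; inj₂)
open import Data.Unit using (tt)
open import Function using (_∘_; _on_; id)
open import Function.Bundles using (_⇔_; mk⇔; Equivalence)
open import Induction.WellFounded using (Acc; acc)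
import Relation.Binary.Construct.On as On
open import Relation.Binary.PropositionalEquality using (refl; sym; trans; cong; cong₂; subst; _≗_; module ≡-Reasoning)

⟦_⟧ : Bool → ℤ
⟦ true  ⟧ = + 1
⟦ false ⟧ = + 0

⟦∧⟧ : ∀ a b → ⟦ a ∧ b ⟧ ≡ ⟦ a ⟧ * ⟦ b ⟧
⟦∧⟧ true  b = sym (ℤ.*-identityˡ ⟦ b ⟧)
⟦∧⟧ false b = refl

if-then-0≡⟦⟧* : ∀ b s → (if b then s else + 0) ≡ ⟦ b ⟧ * s
if-then-0≡⟦⟧* true  s = sym (ℤ.*-identityˡ s)
if-then-0≡⟦⟧* false s = refl

∑ : {A : Set} → (A → ℤ) → List A → ℤ
∑ f []       = + 0
∑ f (x ∷ xs) = f x + ∑ f xs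

module _ {A : Set} where

  ∑-++ : ∀ (f : A → ℤ) xs ys → ∑ f (xs ++ ys) ≡ ∑ f xs + ∑ f ys
  ∑-++ f []       ys = sym (ℤ.+-identityˡ _)
  ∑-++ f (x ∷ xs) ys = trans (cong (_+_ (f x)) (∑-++ f xs ys)) (sym (ℤ.+-assoc (f x) _ _))

  ∑-cong : ∀ {f g : A → ℤ} → (∀ x → f x ≡ g x) → ∀ xs → ∑ f xs ≡ ∑ g xs
  ∑-cong f≗g []       = refl
  ∑-cong f≗g (x ∷ xs) = cong₂ _+_ (f≗g x) (∑-cong f≗g xs)

  ∑-zero : ∀ xs → ∑ {A} (λ _ → + 0) xs ≡ + 0
  ∑-zero []       = refl
  ∑-zero (_ ∷ xs) = trans (ℤ.+-identityˡ _) (∑-zero xs)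

  ∑-+ : ∀ (f g : A → ℤ) xs → ∑ (λ x → f x + g x) xs ≡ ∑ f xs + ∑ g xs
  ∑-+ f g []       = refl
  ∑-+ f g (x ∷ xs) = trans (cong (_+_ (f x + g x)) (∑-+ f g xs)) (interchange (f x) (g x) _ _)
    where
    interchange : ∀ a b c d → a + b + (c + d) ≡ a + c + (b + d)
    interchange = solve-∀

  ∑-*ˡ : ∀ c (f : A → ℤ) xs → ∑ (λ x → c * f x) xs ≡ c * ∑ f xs
  ∑-*ˡ c f []       = sym (ℤ.*-zeroʳ c)
  ∑-*ˡ c f (x ∷ xs) = trans (cong (_+_ (c * f x)) (∑-*ˡ c f xs)) (sym (ℤ.*-distribˡ-+ c (f x) _))

  ∑-*ʳ : ∀ c (f : A → ℤ) xs → ∑ (λ x → f x * c) xs ≡ ∑ f xs * c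
  ∑-*ʳ c f []       = refl
  ∑-*ʳ c f (x ∷ xs) = trans (cong (_+_ (f x * c)) (∑-*ʳ c f xs)) (sym (ℤ.*-distribʳ-+ c (f x) _))

  ∑-neg : ∀ (f : A → ℤ) xs → ∑ (λ x → - f x) xs ≡ - ∑ f xs
  ∑-neg f []       = refl
  ∑-neg f (x ∷ xs) = trans (cong (_+_ (- f x)) (∑-neg f xs)) (sym (ℤ.neg-distrib-+ (f x) _))

module _ {A B : Set} where

  ∑-map : ∀ (f : B → ℤ) (g : A → B) xs → ∑ f (map g xs) ≡ ∑ (f ∘ g) xs
  ∑-map f g []       = refl
  ∑-map f g (x ∷ xs) = cong (_+_ (f (g x))) (∑-map f g xs)

  ∑-comm : ∀ (h : A → B → ℤ) as bs → ∑ (λ a → ∑ (h a) bs) as ≡ ∑ (λ b → ∑ (λ a → h a b) as) bs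
  ∑-comm h []       bs = sym (∑-zero bs)
  ∑-comm h (a ∷ as) bs =
    trans (cong (_+_ (∑ (h a) bs)) (∑-comm h as bs)) (sym (∑-+ (h a) (λ b → ∑ (λ a → h a b) as) bs))

sumℤ-map : ∀ {A : Set} (f : A → ℤ) xs → sumℤ (map f xs) ≡ ∑ f xs
sumℤ-map f []       = refl
sumℤ-map f (x ∷ xs) = cong (_+_ (f x)) (sumℤ-map f xs)

sgn : {A : Set} → List A → ℤ
sgn []      = + 1
sgn (_ ∷ S) = - sgn S

sign-length : ∀ {A : Set} (S : List A) → sign (length S) ≡ - sgn S
sign-length []      = refl
sign-length (_ ∷ S) = trans (sign-suc (length S)) (cong -_ (sign-length S))
  where
  sign-suc : ∀ j → sign (suc j) ≡ - sign j
  sign-suc j with odd j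
  ... | true  = refl
  ... | false = refl

any : {A : Set} → (A → Bool) → List A → Bool
any p []       = false
any p (x ∷ xs) = p x ∨ any p xs

all-not≡not-any : ∀ {A : Set} (g : A → Bool) xs → all (not ∘ g) xs ≡ not (any g xs)
all-not≡not-any g []       = refl
all-not≡not-any g (x ∷ xs) with g x
... | true  = refl
... | false = all-not≡not-any g xs

module _ {A : Set} where

  ∑-subsets-∷ : ∀ (h : List A → ℤ) x xs →
    ∑ h (subsets (x ∷ xs)) ≡ ∑ h (subsets xs) + ∑ (h ∘ (x ∷_)) (subsets xs)
  ∑-subsets-∷ h x xs =
    trans (∑-++ h (subsets xs) _) (cong (_+_ (∑ h (subsets xs))) (∑-map h (x ∷_) (subsets xs)))

  inclusion–exclusion : ∀ (q : A → Bool) L →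
    ⟦ all (not ∘ q) L ⟧ ≡ ∑ (λ T → sgn T * ⟦ all q T ⟧) (subsets L)
  inclusion–exclusion q []      = refl
  inclusion–exclusion q (c ∷ L) = begin
      ⟦ not (q c) ∧ all (not ∘ q) L ⟧
    ≡⟨ ⟦∧⟧ (not (q c)) _ ⟩
      ⟦ not (q c) ⟧ * ⟦ all (not ∘ q) L ⟧
    ≡⟨ cong (⟦ not (q c) ⟧ *_) (inclusion–exclusion q L) ⟩
      ⟦ not (q c) ⟧ * R
    ≡⟨ ⟦not⟧* (q c) R ⟩
      R + ⟦ q c ⟧ * - R
    ≡⟨ cong (_+_ R) (sym terms-with-c) ⟩
      R + ∑ (k ∘ (c ∷_)) (subsets L)
    ≡⟨ sym (∑-subsets-∷ k c L) ⟩
      ∑ k (subsets (c ∷ L)) ∎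
    where
    open ≡-Reasoning
    k : List A → ℤ
    k T = sgn T * ⟦ all q T ⟧
    R : ℤ
    R = ∑ k (subsets L)
    ⟦not⟧* : ∀ b r → ⟦ not b ⟧ * r ≡ r + ⟦ b ⟧ * - r
    ⟦not⟧* true  = solve-∀
    ⟦not⟧* false = solve-∀
    terms-with-c : ∑ (k ∘ (c ∷_)) (subsets L) ≡ ⟦ q c ⟧ * - R
    terms-with-c = begin
        ∑ (k ∘ (c ∷_)) (subsets L)
      ≡⟨ ∑-cong (λ T → trans (cong (- sgn T *_) (⟦∧⟧ (q c) (all q T))) (rearrange (sgn T) ⟦ q c ⟧ _))
                (subsets L) ⟩
        ∑ (λ T → ⟦ q c ⟧ * - k T) (subsets L)
      ≡⟨ ∑-*ˡ ⟦ q c ⟧ (λ T → - k T) (subsets L) ⟩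
        ⟦ q c ⟧ * ∑ (λ T → - k T) (subsets L)
      ≡⟨ cong (⟦ q c ⟧ *_) (∑-neg k (subsets L)) ⟩
        ⟦ q c ⟧ * - R ∎
      where
      rearrange : ∀ s a b → - s * (a * b) ≡ a * - (s * b)
      rearrange = solve-∀

  ∑-nonEmpty-subsets : ∀ (h : List A → ℤ) P →
    ∑ (λ S → ⟦ nonEmpty S ⟧ * h S) (subsets P) ≡ ∑ h (subsets P) - h []
  ∑-nonEmpty-subsets h []      = cancel (h [])
    where
    cancel : ∀ a → + 0 ≡ a + + 0 - a
    cancel = solve-∀
  ∑-nonEmpty-subsets h (q ∷ P) = begin
      ∑ k (subsets (q ∷ P))
    ≡⟨ ∑-subsets-∷ k q P ⟩
      ∑ k (subsets P) + ∑ (k ∘ (q ∷_)) (subsets P)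
    ≡⟨ cong₂ _+_ (∑-nonEmpty-subsets h P) (∑-cong (λ S → ℤ.*-identityˡ (h (q ∷ S))) (subsets P)) ⟩
      ∑ h (subsets P) - h [] + ∑ (h ∘ (q ∷_)) (subsets P)
    ≡⟨ rearrange (∑ h (subsets P)) (h []) _ ⟩
      ∑ h (subsets P) + ∑ (h ∘ (q ∷_)) (subsets P) - h []
    ≡⟨ cong (_- h []) (sym (∑-subsets-∷ h q P)) ⟩
      ∑ h (subsets (q ∷ P)) - h [] ∎
    where
    open ≡-Reasoning
    k : List A → ℤ
    k S = ⟦ nonEmpty S ⟧ * h S
    rearrange : ∀ a b c → a - b + c ≡ a + c - b
    rearrange = solve-∀

  ⟦any⟧≡∑-nonEmpty-subsets : ∀ (g : A → Bool) P →
    ∑ (λ S → ⟦ all g S ⟧ * (⟦ nonEmpty S ⟧ * sign (length S))) (subsets P) ≡ ⟦ any g P ⟧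
  ⟦any⟧≡∑-nonEmpty-subsets g P = begin
      ∑ (λ S → ⟦ all g S ⟧ * (⟦ nonEmpty S ⟧ * sign (length S))) (subsets P)
    ≡⟨ ∑-cong (λ S → trans (cong (λ s → ⟦ all g S ⟧ * (⟦ nonEmpty S ⟧ * s)) (sign-length S))
                         (rearrange ⟦ all g S ⟧ ⟦ nonEmpty S ⟧ (sgn S))) (subsets P) ⟩
      ∑ (λ S → ⟦ nonEmpty S ⟧ * - k S) (subsets P)
    ≡⟨ ∑-nonEmpty-subsets (λ S → - k S) P ⟩
      ∑ (λ S → - k S) (subsets P) + + 1
    ≡⟨ cong (λ s → s + + 1) (∑-neg k (subsets P)) ⟩
      - ∑ k (subsets P) + + 1
    ≡⟨ cong (λ s → - s + + 1) (sym (inclusion–exclusion g P)) ⟩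
      - ⟦ all (not ∘ g) P ⟧ + + 1
    ≡⟨ cong (λ b → - ⟦ b ⟧ + + 1) (all-not≡not-any g P) ⟩
      - ⟦ not (any g P) ⟧ + + 1
    ≡⟨ 1-⟦not⟧ (any g P) ⟩
      ⟦ any g P ⟧ ∎
    where
    open ≡-Reasoning
    k : List A → ℤ
    k S = sgn S * ⟦ all g S ⟧
    rearrange : ∀ a n s → a * (n * - s) ≡ n * - (s * a)
    rearrange = solve-∀
    1-⟦not⟧ : ∀ b → - ⟦ not b ⟧ + + 1 ≡ ⟦ b ⟧
    1-⟦not⟧ true  = refl
    1-⟦not⟧ false = refl

T-injective : ∀ {a b} → T a ⇔ T b → a ≡ b
T-injective {false} {false} _   = refl
T-injective {false} {true}  a⇔b = ⊥-elim (Equivalence.from a⇔b tt)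
T-injective {true}  {false} a⇔b = ⊥-elim (Equivalence.to a⇔b tt)
T-injective {true}  {true}  _   = refl

¬T⇒T-not : ∀ {b} → ¬ T b → T (not b)
¬T⇒T-not {true}  ¬t = ¬t tt
¬T⇒T-not {false} _  = tt

T-not⇒¬T : ∀ {b} → T (not b) → ¬ T b
T-not⇒¬T {true} ()

¬T-not : ∀ {b} → ¬ T (not b) → T b
¬T-not {true}  _  = tt
¬T-not {false} ¬t = ¬t tt

¬T-∨ : ∀ {a b} → ¬ T (a ∨ b) → ¬ T a × ¬ T b
¬T-∨ ¬t = (λ t → ¬t (Equivalence.from T-∨ (inj₁ t))) , (λ t → ¬t (Equivalence.from T-∨ (inj₂ t)))

module _ {A : Set} {p : A → Bool} where

  T-all⁻ : ∀ {xs} → T (all p xs) → ∀ {x} → x ∈ xs → T (p x)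
  T-all⁻ {_ ∷ _} t (here refl) = proj₁ (Equivalence.to T-∧ t)
  T-all⁻ {_ ∷ _} t (there x∈) = T-all⁻ (proj₂ (Equivalence.to T-∧ t)) x∈

  T-all⁺ : ∀ xs → (∀ {x} → x ∈ xs → T (p x)) → T (all p xs)
  T-all⁺ []       _ = tt
  T-all⁺ (x ∷ xs) h = Equivalence.from T-∧ (h (here refl) , T-all⁺ xs (h ∘ there))

  ¬T-all : ∀ xs → ¬ T (all p xs) → ∃[ x ] (x ∈ xs × ¬ T (p x))
  ¬T-all []       ¬t = ⊥-elim (¬t tt)
  ¬T-all (x ∷ xs) ¬t with p x in eq
  ... | false = x , here refl , λ t → subst T eq t
  ... | true  with y , y∈ , ¬py ← ¬T-all xs ¬t = y , there y∈ , ¬py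

  T-any⁻ : ∀ {xs} → T (any p xs) → ∃[ x ] (x ∈ xs × T (p x))
  T-any⁻ {x ∷ xs} t with p x in eq
  ... | true  = x , here refl , subst T (sym eq) tt
  ... | false with y , y∈ , py ← T-any⁻ {xs} t = y , there y∈ , py

  T-any⁺ : ∀ {xs x} → x ∈ xs → T (p x) → T (any p xs)
  T-any⁺ {y ∷ _} (here refl) t = Equivalence.from T-∨ (inj₁ t)
  T-any⁺ {y ∷ _} (there x∈)  t = Equivalence.from T-∨ (inj₂ (T-any⁺ x∈ t))

_≤ₚ_ : ∀ {n} → Vec' n → Vec' n → Set
u ≤ₚ v = ∀ i → u i ≤ v i

Monotone : (n : ℕ) → (Fin n → ℕ) → (Vec' n → Bool) → Set
Monotone n m f = ∀ {u v} → InStates m u → InStates m v → u ≤ₚ v → T (f u) → T (f v)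

Monotone-∘ : ∀ {n n′ m m′ f} → Monotone n m f → (g : Vec' n′ → Vec' n) →
  (∀ {u} → InStates m′ u → InStates m (g u)) → (∀ {u v} → u ≤ₚ v → g u ≤ₚ g v) →
  Monotone n′ m′ (f ∘ g)
Monotone-∘ mono g g∈ g-mono u∈ v∈ u≤v = mono (g∈ u∈) (g∈ v∈) (g-mono u≤v)

Monotone-cong : ∀ {n m f} → Monotone n m f → ∀ {u v} → InStates m u → u ≗ v → f u ≡ f v
Monotone-cong mono {u} {v} u∈ u≗v = T-injective (mk⇔ (mono u∈ v∈ (λ i → ℕ.≤-reflexive (u≗v i)))
                                                    (mono v∈ u∈ (λ i → ℕ.≤-reflexive (sym (u≗v i)))))
  where
  v∈ : InStates _ v
  v∈ i = subst (_≤ _) (u≗v i) (u∈ i)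

module _ {n : ℕ} {u v : Vec' n} where

  ≤ᵥ⇒≤ₚ : T (u ≤ᵥ v) → u ≤ₚ v
  ≤ᵥ⇒≤ₚ t i = ℕ.≤ᵇ⇒≤ (u i) (v i) (T-all⁻ t (∈-allFin i))

  ≤ₚ⇒≤ᵥ : u ≤ₚ v → T (u ≤ᵥ v)
  ≤ₚ⇒≤ᵥ u≤v = T-all⁺ (allFin n) (λ {i} _ → ℕ.≤⇒≤ᵇ (u≤v i))

  ≡ᵥ⇒≗ : T (u ≡ᵥ v) → u ≗ v
  ≡ᵥ⇒≗ t i = ℕ.≡ᵇ⇒≡ (u i) (v i) (T-all⁻ t (∈-allFin i))

  ≗⇒≡ᵥ : u ≗ v → T (u ≡ᵥ v)
  ≗⇒≡ᵥ u≗v = T-all⁺ (allFin n) (λ {i} _ → ℕ.≡⇒≡ᵇ (u i) (v i) (u≗v i))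

module _ {n : ℕ} (x : Vec' n) where

  ∈-Alist⁺ : ∀ {i} → 0 < x i → i ∈ Alist x
  ∈-Alist⁺ {i} 0<xᵢ = ∈-filter⁺ (λ j → T? (0 <ᵇ x j)) (∈-allFin i) (ℕ.<⇒<ᵇ 0<xᵢ)

  ∈-Alist⁻ : ∀ {i} → i ∈ Alist x → 0 < x i
  ∈-Alist⁻ {i} i∈ = ℕ.<ᵇ⇒< 0 (x i) (proj₂ (∈-filter⁻ (λ j → T? (0 <ᵇ x j)) {xs = allFin n} i∈))

module _ {n : ℕ} (i : Fin n) where

  vmax-upper : ∀ {S p} → p ∈ S → p i ≤ vmax S i
  vmax-upper {q ∷ S} (here refl) = ℕ.m≤m⊔n (q i) _
  vmax-upper {q ∷ S} (there p∈)  = ℕ.≤-trans (vmax-upper p∈) (ℕ.m≤n⊔m (q i) _)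

  vmax-least : ∀ S {c} → (∀ {p} → p ∈ S → p i ≤ c) → vmax S i ≤ c
  vmax-least []      _ = z≤n
  vmax-least (q ∷ S) h = ℕ.⊔-lub (h (here refl)) (vmax-least S (h ∘ there))

  vmax-< : ∀ S {c} → 0 < c → (∀ {p} → p ∈ S → p i < c) → vmax S i < c
  vmax-< []      0<c _ = 0<c
  vmax-< (q ∷ S) 0<c h = ℕ.⊔-lub (h (here refl)) (vmax-< S 0<c (h ∘ there))

module _ {n : ℕ} (x : Vec' n) where

  vmax≡ᵥ⇔ : ∀ S →
    T (vmax S ≡ᵥ x) ⇔ T (all (_≤ᵥ x) S ∧ all (not ∘ λ i → all (λ p → p i <ᵇ x i) S) (Alist x))
  vmax≡ᵥ⇔ S = mk⇔ to from
    where
    to : T (vmax S ≡ᵥ x) → T (all (_≤ᵥ x) S ∧ all (not ∘ λ i → all (λ p → p i <ᵇ x i) S) (Alist x))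
    to t = Equivalence.from T-∧ (bounded , attained)
      where
      vmax≗x : vmax S ≗ x
      vmax≗x = ≡ᵥ⇒≗ t
      bounded : T (all (_≤ᵥ x) S)
      bounded = T-all⁺ S (λ {p} p∈ → ≤ₚ⇒≤ᵥ (λ i → subst (p i ≤_) (vmax≗x i) (vmax-upper i p∈)))
      attained : T (all (not ∘ λ i → all (λ p → p i <ᵇ x i) S) (Alist x))
      attained = T-all⁺ (Alist x) (λ {i} i∈ → ¬T⇒T-not λ all< →
        ℕ.<-irrefl (vmax≗x i)
          (vmax-< i S (∈-Alist⁻ x i∈) (λ {p} p∈ → ℕ.<ᵇ⇒< (p i) (x i) (T-all⁻ all< p∈))))
    from : T (all (_≤ᵥ x) S ∧ all (not ∘ λ i → all (λ p → p i <ᵇ x i) S) (Alist x)) → T (vmax S ≡ᵥ x)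
    from t = ≗⇒≡ᵥ (λ i → ℕ.≤-antisym (upper i) (lower i))
      where
      bounded : T (all (_≤ᵥ x) S)
      bounded = proj₁ (Equivalence.to T-∧ t)
      attained : T (all (not ∘ λ i → all (λ p → p i <ᵇ x i) S) (Alist x))
      attained = proj₂ (Equivalence.to T-∧ t)
      upper : ∀ i → vmax S i ≤ x i
      upper i = vmax-least i S (λ {p} p∈ → ≤ᵥ⇒≤ₚ {u = p} (T-all⁻ bounded p∈) i)
      lower : ∀ i → x i ≤ vmax S i
      lower i = ℕ.≮⇒≥ λ vmax<x →
        T-not⇒¬T (T-all⁻ attained (∈-Alist⁺ x (ℕ.≤-<-trans z≤n vmax<x)))
                 (T-all⁺ S (λ p∈ → ℕ.<⇒<ᵇ (ℕ.≤-<-trans (vmax-upper i p∈) vmax<x)))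

∑-cong∈ : ∀ {A : Set} {f g : A → ℤ} xs → (∀ {x} → x ∈ xs → f x ≡ g x) → ∑ f xs ≡ ∑ g xs
∑-cong∈ []       _   = refl
∑-cong∈ (x ∷ xs) f≗g = cong₂ _+_ (f≗g (here refl)) (∑-cong∈ xs (f≗g ∘ there))

∈-subsets⇒⊆ : ∀ {A : Set} (L : List A) {I} → I ∈ subsets L → ∀ {i} → i ∈ I → i ∈ L
∈-subsets⇒⊆ []      (here refl) ()
∈-subsets⇒⊆ (x ∷ L) I∈ i∈ with ∈-++⁻ (subsets L) I∈
... | inj₁ I∈ˡ = there (∈-subsets⇒⊆ L I∈ˡ i∈)
... | inj₂ I∈ʳ with J , J∈ , refl ← ∈-map⁻ (x ∷_) I∈ʳ with i∈
...   | here refl = here refl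
...   | there i∈J = there (∈-subsets⇒⊆ L J∈ i∈J)

memb : ∀ {n} → Fin n → List (Fin n) → Bool
memb i I = any (λ j → toℕ j ≡ᵇ toℕ i) I

module _ {n : ℕ} {i : Fin n} where

  T-memb⇒∈ : ∀ I → T (memb i I) → i ∈ I
  T-memb⇒∈ I t with j , j∈ , j≡ᵇi ← T-any⁻ {xs = I} t =
    subst (_∈ I) (toℕ-injective (ℕ.≡ᵇ⇒≡ (toℕ j) (toℕ i) j≡ᵇi)) j∈

  ∈⇒T-memb : ∀ {I} → i ∈ I → T (memb i I)
  ∈⇒T-memb i∈ = T-any⁺ i∈ (ℕ.≡⇒≡ᵇ (toℕ i) (toℕ i) refl)

lower : ∀ {n} → List (Fin n) → Vec' n → Vec' n
lower I x i = if memb i I then x i ∸ 1 else x i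

module _ {n : ℕ} (I : List (Fin n)) (x : Vec' n) where

  lower-≤ₚ : lower I x ≤ₚ x
  lower-≤ₚ i with memb i I
  ... | true  = ℕ.m∸n≤m (x i) 1
  ... | false = ℕ.≤-refl

  ≤ₚ-lower⇔ : (∀ {i} → i ∈ I → 0 < x i) → ∀ p →
    p ≤ₚ lower I x ⇔ (p ≤ₚ x × ∀ {i} → i ∈ I → p i < x i)
  ≤ₚ-lower⇔ pos p = mk⇔ to from
    where
    <⇒≤∸1 : ∀ {a b} → a < b → a ≤ b ∸ 1
    <⇒≤∸1 (s≤s a≤b) = a≤b
    to : p ≤ₚ lower I x → p ≤ₚ x × ∀ {i} → i ∈ I → p i < x i
    to p≤ = (λ i → ℕ.≤-trans (p≤ i) (lower-≤ₚ i)) , below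
      where
      below : ∀ {i} → i ∈ I → p i < x i
      below {i} i∈ with memb i I | ∈⇒T-memb i∈ | p≤ i
      ... | true | _ | pᵢ≤ = ℕ.≤-<-trans pᵢ≤ (ℕ.∸-monoʳ-< (s≤s z≤n) (pos i∈))
    from : p ≤ₚ x × (∀ {i} → i ∈ I → p i < x i) → p ≤ₚ lower I x
    from (p≤x , below) i with memb i I in eq
    ... | true  = <⇒≤∸1 (below (T-memb⇒∈ I (subst T (sym eq) tt)))
    ... | false = p≤x i

  all-≤ᵥ-lower⇔ : (∀ {i} → i ∈ I → 0 < x i) → ∀ S →
    T (all (_≤ᵥ x) S ∧ all (λ i → all (λ p → p i <ᵇ x i) S) I) ⇔ T (all (_≤ᵥ lower I x) S)
  all-≤ᵥ-lower⇔ pos S = mk⇔ to from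
    where
    to : T (all (_≤ᵥ x) S ∧ all (λ i → all (λ p → p i <ᵇ x i) S) I) → T (all (_≤ᵥ lower I x) S)
    to t = T-all⁺ S λ {p} p∈ → ≤ₚ⇒≤ᵥ (Equivalence.from (≤ₚ-lower⇔ pos p)
      ( ≤ᵥ⇒≤ₚ {u = p} (T-all⁻ (proj₁ (Equivalence.to T-∧ t)) p∈)
      , λ {i} i∈ → ℕ.<ᵇ⇒< (p i) (x i) (T-all⁻ (T-all⁻ (proj₂ (Equivalence.to T-∧ t)) i∈) p∈)))
    from : T (all (_≤ᵥ lower I x) S) → T (all (_≤ᵥ x) S ∧ all (λ i → all (λ p → p i <ᵇ x i) S) I)
    from t = Equivalence.from T-∧
      ( T-all⁺ S (λ p∈ → ≤ₚ⇒≤ᵥ (proj₁ (split p∈)))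
      , T-all⁺ I (λ i∈ → T-all⁺ S (λ p∈ → ℕ.<⇒<ᵇ (proj₂ (split p∈) i∈))))
      where
      split : ∀ {p} → p ∈ S → p ≤ₚ x × ∀ {i} → i ∈ I → p i < x i
      split {p} p∈ = Equivalence.to (≤ₚ-lower⇔ pos p) (≤ᵥ⇒≤ₚ {u = p} (T-all⁻ t p∈))

module _ {n : ℕ} (x : Vec' n) where

  ⟦vmax≡ᵥ⟧≡∑ : ∀ S →
    ⟦ vmax S ≡ᵥ x ⟧ ≡ ∑ (λ I → sgn I * ⟦ all (_≤ᵥ lower I x) S ⟧) (subsets (Alist x))
  ⟦vmax≡ᵥ⟧≡∑ S = begin
      ⟦ vmax S ≡ᵥ x ⟧
    ≡⟨ cong ⟦_⟧ (T-injective (vmax≡ᵥ⇔ x S)) ⟩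
      ⟦ bounded ∧ all (not ∘ below) (Alist x) ⟧
    ≡⟨ ⟦∧⟧ bounded _ ⟩
      ⟦ bounded ⟧ * ⟦ all (not ∘ below) (Alist x) ⟧
    ≡⟨ cong (⟦ bounded ⟧ *_) (inclusion–exclusion below (Alist x)) ⟩
      ⟦ bounded ⟧ * ∑ (λ I → sgn I * ⟦ all below I ⟧) (subsets (Alist x))
    ≡⟨ sym (∑-*ˡ ⟦ bounded ⟧ _ (subsets (Alist x))) ⟩
      ∑ (λ I → ⟦ bounded ⟧ * (sgn I * ⟦ all below I ⟧)) (subsets (Alist x))
    ≡⟨ ∑-cong∈ (subsets (Alist x)) (λ {I} I∈ → term I (∈-Alist⁻ x ∘ ∈-subsets⇒⊆ (Alist x) I∈)) ⟩
      ∑ (λ I → sgn I * ⟦ all (_≤ᵥ lower I x) S ⟧) (subsets (Alist x)) ∎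
    where
    open ≡-Reasoning
    bounded : Bool
    bounded = all (_≤ᵥ x) S
    below : Fin n → Bool
    below i = all (λ p → p i <ᵇ x i) S
    term : ∀ I → (∀ {i} → i ∈ I → 0 < x i) →
      ⟦ bounded ⟧ * (sgn I * ⟦ all below I ⟧) ≡ sgn I * ⟦ all (_≤ᵥ lower I x) S ⟧
    term I pos = begin
        ⟦ bounded ⟧ * (sgn I * ⟦ all below I ⟧)
      ≡⟨ x∙yz≈y∙xz ⟦ bounded ⟧ (sgn I) _ ⟩
        sgn I * (⟦ bounded ⟧ * ⟦ all below I ⟧)
      ≡⟨ cong (sgn I *_) (sym (⟦∧⟧ bounded _)) ⟩
        sgn I * ⟦ bounded ∧ all below I ⟧
      ≡⟨ cong (λ b → sgn I * ⟦ b ⟧) (T-injective (all-≤ᵥ-lower⇔ I x pos S)) ⟩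
        sgn I * ⟦ all (_≤ᵥ lower I x) S ⟧ ∎

states-sound : ∀ n (m : Fin n → ℕ) {w} → w ∈ states n m → InStates m w
states-sound zero    m _ ()
states-sound (suc n) m w∈ i with v , v∈ , w∈ᵥ ← find (∈-concatMap⁻ _ {xs = states n (m ∘ Fin.suc)} w∈)
                            with k , k∈ , refl ← ∈-map⁻ _ w∈ᵥ | i
... | zero  = ℕ.≤-pred (∈-upTo⁻ k∈)
... | suc j = states-sound n (m ∘ Fin.suc) v∈ j

-- Only up to pointwise equality, vectors being functions.
states-complete : ∀ n (m : Fin n → ℕ) w → InStates m w → ∃[ w′ ] (w′ ∈ states n m × w′ ≗ w)
states-complete zero    m w _  = _ , here refl , λ ()
states-complete (suc n) m w w∈ with v , v∈ , v≗ ← states-complete n (m ∘ Fin.suc) (w ∘ Fin.suc) (w∈ ∘ Fin.suc) =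
  _ , ∈-concatMap⁺ _ (lose v∈ (∈-map⁺ _ (∈-upTo⁺ (s≤s (w∈ zero))))) , λ { zero → refl ; (suc i) → v≗ i }

total : ∀ {n} → Vec' n → ℕ
total {zero}  _ = 0
total {suc n} u = u zero ℕ.+ total (u ∘ Fin.suc)

total-mono : ∀ {n} {u v : Vec' n} → u ≤ₚ v → total u ≤ total v
total-mono {zero}  _   = z≤n
total-mono {suc n} u≤v = ℕ.+-mono-≤ (u≤v zero) (total-mono (u≤v ∘ Fin.suc))

total-< : ∀ {n} {u v : Vec' n} → u ≤ₚ v → ∀ j → u j < v j → total u < total v
total-< {suc n} u≤v zero    uⱼ<vⱼ = ℕ.+-mono-<-≤ uⱼ<vⱼ (total-mono (u≤v ∘ Fin.suc))
total-< {suc n} u≤v (suc j) uⱼ<vⱼ = ℕ.+-mono-≤-< (u≤v zero) (total-< (u≤v ∘ Fin.suc) j uⱼ<vⱼ)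

module _ {n : ℕ} {m : Fin n → ℕ} {f : Vec' n → Bool} where

  minPath-sound : ∀ {p} → p ∈ minPaths n m f → p ∈ states n m × T (f p)
  minPath-sound p∈ with p∈states , t ← ∈-filter⁻ (T? ∘ isMinPath n m f) p∈ =
    p∈states , proj₁ (Equivalence.to T-∧ t)

  ¬minPath⇒smaller : ∀ {x} → T (f x) → ¬ T (isMinPath n m f x) →
    ∃[ y ] (y ∈ states n m × T (f y) × y ≤ₚ x × total y < total x)
  ¬minPath⇒smaller {x} fx ¬min
    with y , y∈ , ¬t ← ¬T-all (states n m) (λ t → ¬min (Equivalence.from T-∧ (fx , t)))
    with ¬y≰x , ¬rest ← ¬T-∨ ¬t
    with ¬y≡x , ¬¬fy ← ¬T-∨ {y ≡ᵥ x} ¬rest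
    with j , _ , yⱼ≢xⱼ ← ¬T-all {p = λ i → y i ≡ᵇ x i} (allFin n) ¬y≡x =
    y , y∈ , ¬T-not ¬¬fy , y≤x ,
    total-< y≤x j (ℕ.≤∧≢⇒< (y≤x j) (yⱼ≢xⱼ ∘ ℕ.≡⇒≡ᵇ (y j) (x j)))
    where
    y≤x : y ≤ₚ x
    y≤x = ≤ᵥ⇒≤ₚ (¬T-not ¬y≰x)

  module _ (mono : Monotone n m f) where

    below-minPath : ∀ w → InStates m w → T (f w) → ∃[ p ] (p ∈ minPaths n m f × p ≤ₚ w)
    below-minPath w = descend w (On.wellFounded total <-wellFounded w)
      where
      descend : ∀ w → Acc (_<_ on total) w → InStates m w → T (f w) → ∃[ p ] (p ∈ minPaths n m f × p ≤ₚ w)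
      descend w (acc smaller) w∈ fw with w′ , w′∈ , w′≗w ← states-complete n m w w∈ =
        descend′ w′∈ (λ i → ℕ.≤-reflexive (w′≗w i))
                 (mono w∈ (states-sound n m w′∈) (λ i → ℕ.≤-reflexive (sym (w′≗w i))) fw)
        where
        descend′ : ∀ {w′} → w′ ∈ states n m → w′ ≤ₚ w → T (f w′) →
          ∃[ p ] (p ∈ minPaths n m f × p ≤ₚ w)
        descend′ {w′} w′∈ w′≤w fw′ with isMinPath n m f w′ in eq
        ... | true = w′ , ∈-filter⁺ (T? ∘ isMinPath n m f) w′∈ (subst T (sym eq) tt) , w′≤w
        ... | false
          with y , y∈ , fy , y≤w′ , y<w′ ← ¬minPath⇒smaller fw′ (λ t → subst T eq t)
          with p , p∈ , p≤y ←
                 descend y (smaller (ℕ.<-≤-trans y<w′ (total-mono w′≤w))) (states-sound n m y∈) fy =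
          p , p∈ , λ i → ℕ.≤-trans (p≤y i) (ℕ.≤-trans (y≤w′ i) (w′≤w i))

    any-minPath-≤ᵥ : ∀ w → InStates m w → any (_≤ᵥ w) (minPaths n m f) ≡ f w
    any-minPath-≤ᵥ w w∈ = T-injective (mk⇔ to from)
      where
      to : T (any (_≤ᵥ w) (minPaths n m f)) → T (f w)
      to t with p , p∈ , p≤w ← T-any⁻ t with p∈states , fp ← minPath-sound p∈ =
        mono (states-sound n m p∈states) w∈ (≤ᵥ⇒≤ₚ p≤w) fp
      from : T (f w) → T (any (_≤ᵥ w) (minPaths n m f))
      from fw with p , p∈ , p≤w ← below-minPath w w∈ fw = T-any⁺ p∈ (≤ₚ⇒≤ᵥ p≤w)

δ-expansion : ∀ n (m : Fin n → ℕ) (f : Vec' n → Bool) → Monotone n m f →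
  ∀ x → InStates m x → δ n m f x ≡ ∑ (λ I → sgn I * ⟦ f (lower I x) ⟧) (subsets (Alist x))
δ-expansion n m f mono x x∈ = begin
    δ n m f x
  ≡⟨ sumℤ-map _ (subsets P) ⟩
    ∑ (λ S → if nonEmpty S ∧ (vmax S ≡ᵥ x) then sign (length S) else + 0) (subsets P)
  ≡⟨ ∑-cong formation-weight (subsets P) ⟩
    ∑ (λ S → ⟦ vmax S ≡ᵥ x ⟧ * w S) (subsets P)
  ≡⟨ ∑-cong expand (subsets P) ⟩
    ∑ (λ S → ∑ (λ I → sgn I * (⟦ all (_≤ᵥ lower I x) S ⟧ * w S)) (subsets A)) (subsets P)
  ≡⟨ ∑-comm (λ S I → sgn I * (⟦ all (_≤ᵥ lower I x) S ⟧ * w S)) (subsets P) (subsets A) ⟩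
    ∑ (λ I → ∑ (λ S → sgn I * (⟦ all (_≤ᵥ lower I x) S ⟧ * w S)) (subsets P)) (subsets A)
  ≡⟨ ∑-cong (λ I → trans (∑-*ˡ (sgn I) _ (subsets P))
                         (cong (sgn I *_) (⟦any⟧≡∑-nonEmpty-subsets (_≤ᵥ lower I x) P))) (subsets A) ⟩
    ∑ (λ I → sgn I * ⟦ any (_≤ᵥ lower I x) P ⟧) (subsets A)
  ≡⟨ ∑-cong (λ I → cong (λ b → sgn I * ⟦ b ⟧) (any-minPath-≤ᵥ mono (lower I x) (lower∈ I))) (subsets A) ⟩
    ∑ (λ I → sgn I * ⟦ f (lower I x) ⟧) (subsets A) ∎
  where
  open ≡-Reasoning
  P : List (Vec' n)
  P = minPaths n m f
  A : List (Fin n)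
  A = Alist x
  w : List (Vec' n) → ℤ
  w S = ⟦ nonEmpty S ⟧ * sign (length S)
  formation-weight : ∀ S →
    (if nonEmpty S ∧ (vmax S ≡ᵥ x) then sign (length S) else + 0) ≡ ⟦ vmax S ≡ᵥ x ⟧ * w S
  formation-weight S = begin
      (if nonEmpty S ∧ (vmax S ≡ᵥ x) then sign (length S) else + 0)
    ≡⟨ if-then-0≡⟦⟧* (nonEmpty S ∧ (vmax S ≡ᵥ x)) _ ⟩
      ⟦ nonEmpty S ∧ (vmax S ≡ᵥ x) ⟧ * sign (length S)
    ≡⟨ cong (_* sign (length S)) (⟦∧⟧ (nonEmpty S) _) ⟩
      ⟦ nonEmpty S ⟧ * ⟦ vmax S ≡ᵥ x ⟧ * sign (length S)
    ≡⟨ trans (ℤ.*-assoc ⟦ nonEmpty S ⟧ _ _)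
             (x∙yz≈y∙xz ⟦ nonEmpty S ⟧ ⟦ vmax S ≡ᵥ x ⟧ (sign (length S))) ⟩
      ⟦ vmax S ≡ᵥ x ⟧ * w S ∎
  expand : ∀ S →
    ⟦ vmax S ≡ᵥ x ⟧ * w S ≡ ∑ (λ I → sgn I * (⟦ all (_≤ᵥ lower I x) S ⟧ * w S)) (subsets A)
  expand S = begin
      ⟦ vmax S ≡ᵥ x ⟧ * w S
    ≡⟨ cong (_* w S) (⟦vmax≡ᵥ⟧≡∑ x S) ⟩
      ∑ (λ I → sgn I * ⟦ all (_≤ᵥ lower I x) S ⟧) (subsets A) * w S
    ≡⟨ sym (∑-*ʳ (w S) _ (subsets A)) ⟩
      ∑ (λ I → sgn I * ⟦ all (_≤ᵥ lower I x) S ⟧ * w S) (subsets A)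
    ≡⟨ ∑-cong (λ I → ℤ.*-assoc (sgn I) _ (w S)) (subsets A) ⟩
      ∑ (λ I → sgn I * (⟦ all (_≤ᵥ lower I x) S ⟧ * w S)) (subsets A) ∎
  lower∈ : ∀ I → InStates m (lower I x)
  lower∈ I i = ℕ.≤-trans (lower-≤ₚ I x i) (x∈ i)

lookup-injective : ∀ {A : Set} {L : List A} → Unique L → ∀ {s t} → lookup L s ≡ lookup L t → s ≡ t
lookup-injective {L = x ∷ L} _          {zero}  {zero}  _ = refl
lookup-injective {L = x ∷ L} (x∉ ∷ _)   {zero}  {suc t} e = ⊥-elim (All.lookup x∉ (∈-lookup t) e)
lookup-injective {L = x ∷ L} (x∉ ∷ _)   {suc s} {zero}  e = ⊥-elim (All.lookup x∉ (∈-lookup s) (sym e))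
lookup-injective {L = x ∷ L} (_ ∷ uniq) {suc s} {suc t} e = cong suc (lookup-injective uniq e)

memb-map : ∀ {a n} (g : Fin a → Fin n) → (∀ {s t} → g s ≡ g t → s ≡ t) →
  ∀ j I → memb j I ≡ memb (g j) (map g I)
memb-map g g-inj j I = T-injective (mk⇔ (∈⇒T-memb ∘ ∈-map⁺ g ∘ T-memb⇒∈ I) from)
  where
  from : T (memb (g j) (map g I)) → T (memb j I)
  from t with j′ , j′∈ , gj≡gj′ ← ∈-map⁻ g (T-memb⇒∈ (map g I) t) =
    ∈⇒T-memb (subst (_∈ I) (sym (g-inj gj≡gj′)) j′∈)

subsets-map : ∀ {A B : Set} (g : A → B) xs → subsets (map g xs) ≡ map (map g) (subsets xs)
subsets-map g []       = refl
subsets-map g (x ∷ xs) rewrite subsets-map g xs =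
  sym (trans (List.map-++ (map g) (subsets xs) _)
             (cong (map (map g) (subsets xs) ++_) (trans (sym (List.map-∘ (subsets xs))) (List.map-∘ (subsets xs)))))

sgn-map : ∀ {A B : Set} (g : A → B) xs → sgn (map g xs) ≡ sgn xs
sgn-map g []       = refl
sgn-map g (x ∷ xs) = cong -_ (sgn-map g xs)

sum-scatter : ∀ {n} (L : List (Fin n)) → Unique L → (z : Fin (length L) → ℕ) (h : Fin n → ℕ) →
  (∀ j → z j ≡ h (lookup L j)) → ∀ i →
  sum (tabulate (λ j → if toℕ (lookup L j) ≡ᵇ toℕ i then z j else 0)) ≡ (if memb i L then h i else 0)
sum-scatter []      _            z h z≗h i = refl
sum-scatter (x ∷ L) (x∉ ∷ uniq) z h z≗h i
  rewrite sum-scatter L uniq (z ∘ Fin.suc) h (z≗h ∘ Fin.suc) i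
  with toℕ x ≡ᵇ toℕ i in x≡ᵇi
... | false = refl
... | true with toℕ-injective (ℕ.≡ᵇ⇒≡ (toℕ x) (toℕ i) (subst T (sym x≡ᵇi) tt)) | memb i L in i∈?
...   | refl | true  = ⊥-elim (All.lookup x∉ (T-memb⇒∈ L (subst T (sym i∈?) tt)) refl)
...   | refl | false = trans (ℕ.+-identityʳ (z zero)) (z≗h zero)

∑-subsets-map : ∀ {A B : Set} (h : List B → ℤ) (g : A → B) xs →
  ∑ h (subsets (map g xs)) ≡ ∑ (h ∘ map g) (subsets xs)
∑-subsets-map h g xs = trans (cong (∑ h) (subsets-map g xs)) (∑-map h (map g) (subsets xs))

sum-map-mono : ∀ {A : Set} {F G : A → ℕ} xs → (∀ a → F a ≤ G a) → sum (map F xs) ≤ sum (map G xs)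
sum-map-mono []       F≤G = z≤n
sum-map-mono (x ∷ xs) F≤G = ℕ.+-mono-≤ (F≤G x) (sum-map-mono xs F≤G)

𝟏 : ∀ {a} → Vec' a
𝟏 _ = 1

Alist-𝟏 : ∀ a → Alist {a} 𝟏 ≡ allFin a
Alist-𝟏 a = List.filter-all (T? ∘ λ _ → true) (All.universal (λ _ → tt) (allFin a))

ψ-input : ∀ {n} (y : Vec' n) → Vec' (∣A∣ y) → Vec' n
ψ-input y z i = (y i ∸ indA y i) ℕ.+ ext y z i

module _ {n : ℕ} (y : Vec' n) where

  Alist-unique : Unique (Alist y)
  Alist-unique = Unique.filter⁺ (T? ∘ λ i → 0 <ᵇ y i) (Unique.allFin⁺ n)

  map-embA : map (embA y) (allFin (∣A∣ y)) ≡ Alist y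
  map-embA = trans (List.map-tabulate id (embA y)) (List.tabulate-lookup (Alist y))

  memb-Alist : ∀ i → memb i (Alist y) ≡ (0 <ᵇ y i)
  memb-Alist i = T-injective (mk⇔ (ℕ.<⇒<ᵇ ∘ ∈-Alist⁻ y ∘ T-memb⇒∈ (Alist y))
                                  (∈⇒T-memb ∘ ∈-Alist⁺ y ∘ ℕ.<ᵇ⇒< 0 (y i)))

  ext-along : ∀ z h → (∀ j → z j ≡ h (embA y j)) → ∀ i → ext y z i ≡ (if 0 <ᵇ y i then h i else 0)
  ext-along z h z≗h i = begin
      ext y z i
    ≡⟨ cong sum (List.map-tabulate id (λ j → if toℕ (embA y j) ≡ᵇ toℕ i then z j else 0)) ⟩
      sum (tabulate (λ j → if toℕ (embA y j) ≡ᵇ toℕ i then z j else 0))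
    ≡⟨ sum-scatter (Alist y) Alist-unique z h z≗h i ⟩
      (if memb i (Alist y) then h i else 0)
    ≡⟨ cong (λ b → if b then h i else 0) (memb-Alist i) ⟩
      (if 0 <ᵇ y i then h i else 0) ∎
    where open ≡-Reasoning

  ψ-input-lower : ∀ J → ψ-input y (lower J 𝟏) ≗ lower (map (embA y) J) y
  ψ-input-lower J i =
    trans (cong ((y i ∸ indA y i) ℕ.+_) (ext-along (lower J 𝟏) h lower≗h i)) (shift (y i) (memb i (map (embA y) J)))
    where
    h : Fin n → ℕ
    h i = if memb i (map (embA y) J) then 0 else 1
    lower≗h : ∀ j → lower J 𝟏 j ≡ h (embA y j)
    lower≗h j = cong (λ b → if b then 0 else 1) (memb-map (embA y) (lookup-injective Alist-unique) j J)
    shift : ∀ c b → (c ∸ (if 0 <ᵇ c then 1 else 0)) ℕ.+ (if 0 <ᵇ c then (if b then 0 else 1) else 0)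
                  ≡ (if b then c ∸ 1 else c)
    shift zero    true  = refl
    shift zero    false = refl
    shift (suc c) true  = ℕ.+-identityʳ c
    shift (suc c) false = ℕ.+-comm c 1

  ψ-input-mono : ∀ {u v} → u ≤ₚ v → ψ-input y u ≤ₚ ψ-input y v
  ψ-input-mono u≤v i = ℕ.+-monoʳ-≤ (y i ∸ indA y i) (sum-map-mono (allFin (∣A∣ y)) λ j → if-mono (u≤v j))
    where
    if-mono : ∀ {b p q} → p ≤ q → (if b then p else 0) ≤ (if b then q else 0)
    if-mono {true}  p≤q = p≤q
    if-mono {false} _   = z≤n

module _ (S : MMS) (k : ℕ) where
  open MMS S

  φₖ-monotone : Monotone n m (φₖ S k)
  φₖ-monotone {u} {v} u∈ v∈ u≤v t = ℕ.≤⇒≤ᵇ (ℕ.≤-trans (ℕ.≤ᵇ⇒≤ k (φ u) t) (φ-mono u v u∈ v∈ u≤v))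

  ψ-monotone : ∀ {y} → InStates m y → Monotone (∣A∣ y) (λ _ → 1) (ψ S k y)
  ψ-monotone {y} y∈ = Monotone-∘ φₖ-monotone (ψ-input y) ψ-input∈ (ψ-input-mono y)
    where
    ψ-input∈ : ∀ {u} → InStates (λ _ → 1) u → InStates m (ψ-input y u)
    ψ-input∈ u≤𝟏 i =
      ℕ.≤-trans (ψ-input-mono y u≤𝟏 i) (ℕ.≤-trans (ℕ.≤-reflexive (ψ-input-lower y [] i)) (y∈ i))

  expansions-agree : ∀ {y} → InStates m y →
    ∑ (λ I → sgn I * ⟦ φₖ S k (lower I y) ⟧) (subsets (Alist y)) ≡
    ∑ (λ J → sgn J * ⟦ ψ S k y (lower J 𝟏) ⟧) (subsets (Alist {∣A∣ y} 𝟏))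
  expansions-agree {y} y∈ = begin
      ∑ (λ I → sgn I * ⟦ φₖ S k (lower I y) ⟧) (subsets (Alist y))
    ≡⟨ cong (λ L → ∑ (λ I → sgn I * ⟦ φₖ S k (lower I y) ⟧) (subsets L)) (sym (map-embA y)) ⟩
      ∑ (λ I → sgn I * ⟦ φₖ S k (lower I y) ⟧) (subsets (map (embA y) (allFin a)))
    ≡⟨ ∑-subsets-map (λ I → sgn I * ⟦ φₖ S k (lower I y) ⟧) (embA y) (allFin a) ⟩
      ∑ (λ J → sgn (map (embA y) J) * ⟦ φₖ S k (lower (map (embA y) J) y) ⟧) (subsets (allFin a))
    ≡⟨ ∑-cong (λ J → cong₂ (λ s b → s * ⟦ b ⟧) (sgn-map (embA y) J)
                           (Monotone-cong φₖ-monotone (lower∈ J) (sym ∘ ψ-input-lower y J))) (subsets (allFin a)) ⟩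
      ∑ (λ J → sgn J * ⟦ ψ S k y (lower J 𝟏) ⟧) (subsets (allFin a))
    ≡⟨ cong (λ L → ∑ (λ J → sgn J * ⟦ ψ S k y (lower J 𝟏) ⟧) (subsets L)) (sym (Alist-𝟏 a)) ⟩
      ∑ (λ J → sgn J * ⟦ ψ S k y (lower J 𝟏) ⟧) (subsets (Alist {a} 𝟏)) ∎
    where
    open ≡-Reasoning
    a : ℕ
    a = ∣A∣ y
    lower∈ : ∀ J → InStates m (lower (map (embA y) J) y)
    lower∈ J i = ℕ.≤-trans (lower-≤ₚ (map (embA y) J) y i) (y∈ i)

theorem5p2 : (S : MMS) (k : ℕ) → 1 ≤ k → k ≤ MMS.M S →
    (y : Fin (MMS.n S) → ℕ) → InStates (MMS.m S) y → ¬ (∀ i → y i ≡ 0) →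
    δₖ S k y ≡ dψ S k y
theorem5p2 S k _ _ y y∈ _ = begin
    δₖ S k y
  ≡⟨ δ-expansion (MMS.n S) (MMS.m S) (φₖ S k) (φₖ-monotone S k) y y∈ ⟩
    ∑ (λ I → sgn I * ⟦ φₖ S k (lower I y) ⟧) (subsets (Alist y))
  ≡⟨ expansions-agree S k y∈ ⟩
    ∑ (λ J → sgn J * ⟦ ψ S k y (lower J 𝟏) ⟧) (subsets (Alist {∣A∣ y} 𝟏))
  ≡⟨ sym (δ-expansion (∣A∣ y) (λ _ → 1) (ψ S k y) (ψ-monotone S k y∈) 𝟏 (λ _ → ℕ.≤-refl)) ⟩
    dψ S k y ∎
  where open ≡-Reasoning
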